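{- Let $a\ge3$ be an integer and define $(g_{a,1}(n))_{n\in\mathbb{N}}$ by $g_{a,1}(n)=0$ for integers $n<0$, $g_{a,1}(0)=a$, $g_{a,1}(1)=1$, and $g_{a,1}(n)=g_{a,1}(n-g_{a,1}(n-1))+g_{a,1}(n-2)$ for $n>1$. If $a$ is even, then for all $n\in\mathbb{N}$, $$g_{a,1}(2n)=\begin{cases}a+n&\text{if }n<a+1,\\ g_{a,1}(2n-2-a)+g_{a,1}(2n-2)&\text{if }n\ge a+1,\end{cases}\qquad g_{a,1}(2n+1)=\begin{cases}1&\text{if }n<a-1,\\ a+1&\text{if }n=a-1,\\ a+2&\text{if }n>a-1.\end{cases}$$ If $a$ is odd, then for all $n\in\mathbb{N}$, $$g_{a,1}(2n)=\begin{cases}a+n&\text{if }n<a,\\ g_{a,1}(2n-1-a)+g_{a,1}(2n-2)&\text{if }n\ge a,\end{cases}\qquad g_{a,1}(2n+1)=\begin{cases}1&\text{if }n<a-1,\\ a+1&\text{if }n\ge a-1.\end{cases}$$ -}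

module Defs where

open import Data.Nat using (ℕ)
open import Data.Integer using (ℤ; +_; _+_; _-_; _*_; _<_; _≤_; 0ℤ; 1ℤ)
open import Relation.Binary.PropositionalEquality using (_≡_)
open import Data.Product using (_×_)

record IsG (a : ℤ) (g : ℤ → ℤ) : Set where
  field
    neg  : ∀ (n : ℤ) → n < 0ℤ → g n ≡ 0ℤ
    at0  : g 0ℤ ≡ a
    at1  : g 1ℤ ≡ 1ℤ
    step : ∀ (n : ℤ) → 1ℤ < n → g n ≡ g (n - g (n - 1ℤ)) + g (n - + 2)

{-# OPTIONS --safe #-}
-- Write E n = g(2n) and O n = g(2n+1), so that E (n+1) = g(2n+2 - O n) + E n and
-- O (n+1) = g(2n+3 - E (n+1)) + O n.  While O n = 1, E grows by one per step and
-- E (n+1) = a + n + 1 > 2n + 3 keeps g(2n+3 - E (n+1)) = 0, so O stays 1.  This lasts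
-- until n + 2 = a, where E lands exactly on 2n+3 and O jumps by g 0 = a to a + 1; for
-- even a it jumps once more, by g 1 = 1, to a + 2.  Either way O settles at 2K + 2
-- with K = ⌊a/2⌋, hence E (n+1) = E (n - K) + E n ≥ 2(n+1) + 2, so g(2n+3 - E (n+1)) = 0
-- again and O never moves.
module Submission where

open import Defs
open import Data.Nat as ℕ using (ℕ; zero; suc; s≤s; z≤n)
import Data.Nat.Properties as ℕₚ
open import Data.Nat.Divisibility using (divides; ∣1⇒≡1; ∣m+n∣m⇒∣n)
open import Data.Nat.Induction using (<-rec)
open import Data.Integer using (ℤ; +_; -_; _+_; _-_; _*_; _<_; _≤_; _≥_; _>_; +<+; +≤+; 0ℤ; 1ℤ)
import Data.Integer.Properties as ℤₚ
open import Data.Integer.Tactic.RingSolver using (solve-∀)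
open import Data.Integer.Divisibility using (_∣_)
open import Data.Sum using (_⊎_; inj₁; inj₂)
open import Data.Product using (_×_; _,_; proj₁; proj₂; ∃-syntax)
open import Relation.Nullary using (¬_; yes; no; contradiction)
open import Relation.Binary.PropositionalEquality

i<j⇒i-j<0 : ∀ {i j} → i < j → i - j < 0ℤ
i<j⇒i-j<0 {i} {j} i<j = subst (i - j <_) (ℤₚ.+-inverseʳ j) (ℤₚ.+-monoˡ-< (- j) i<j)

2≤2n+2 : ∀ n → + 2 ≤ + 2 * + n + + 2
2≤2n+2 n = subst (λ i → + 2 ≤ i + + 2) (ℤₚ.pos-* 2 n) (ℤₚ.i≤j+i (+ 2) (+ (2 ℕ.* n)))

module Solution {A : ℕ} {g : ℤ → ℤ} (isG : IsG (+ A) g) where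
  open IsG isG

  E O : ℕ → ℤ
  E n = g (+ 2 * + n)
  O n = g (+ 2 * + n + 1ℤ)

  g-vanishes : ∀ {i j} → i < j → g (i - j) ≡ 0ℤ
  g-vanishes i<j = neg _ (i<j⇒i-j<0 i<j)

  E-suc : ∀ n → E (suc n) ≡ g (+ 2 * + suc n - O n) + E n
  E-suc n = begin
    g i                               ≡⟨ step i (+<+ (ℕₚ.m≤m*n 2 (suc n))) ⟩
    g (i - g (i - 1ℤ)) + g (i - + 2)  ≡⟨ cong₂ (λ u v → g (i - g u) + g v) (shift-odd (+ n)) (shift-even (+ n)) ⟩
    g (i - O n) + E n                 ∎
    where
    open ≡-Reasoning
    i = + 2 * + suc n
    shift-odd : ∀ x → + 2 * (1ℤ + x) - 1ℤ ≡ + 2 * x + 1ℤ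
    shift-odd = solve-∀
    shift-even : ∀ x → + 2 * (1ℤ + x) - + 2 ≡ + 2 * x
    shift-even = solve-∀

  O-suc : ∀ n → O (suc n) ≡ g (+ 2 * + suc n + 1ℤ - E (suc n)) + O n
  O-suc n = begin
    g i                               ≡⟨ step i 1<i ⟩
    g (i - g (i - 1ℤ)) + g (i - + 2)  ≡⟨ cong₂ (λ u v → g (i - g u) + g v) (shift-even (+ n)) (shift-odd (+ n)) ⟩
    g (i - E (suc n)) + O n           ∎
    where
    open ≡-Reasoning
    i = + 2 * + suc n + 1ℤ
    1<i : 1ℤ < i
    1<i = ℤₚ.<-≤-trans (+<+ (ℕₚ.m≤m*n 2 (suc n))) (ℤₚ.i≤i+j _ 1ℤ)
    shift-even : ∀ x → + 2 * (1ℤ + x) + 1ℤ - 1ℤ ≡ + 2 * (1ℤ + x)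
    shift-even = solve-∀
    shift-odd : ∀ x → + 2 * (1ℤ + x) + 1ℤ - + 2 ≡ + 2 * x + 1ℤ
    shift-odd = solve-∀

  [i+j]-i≡j : ∀ i j → i + j - i ≡ j
  [i+j]-i≡j = solve-∀

  E-suc-offset : ∀ n x → O n + x ≡ + 2 * + suc n → E (suc n) ≡ g x + E n
  E-suc-offset n x eq = begin
    E (suc n)                      ≡⟨ E-suc n ⟩
    g (+ 2 * + suc n - O n) + E n  ≡⟨ cong (λ i → g (i - O n) + E n) (sym eq) ⟩
    g (O n + x - O n) + E n        ≡⟨ cong (λ i → g i + E n) ([i+j]-i≡j (O n) x) ⟩
    g x + E n                      ∎
    where open ≡-Reasoning

  O-suc-offset : ∀ n x → E (suc n) + x ≡ + 2 * + suc n + 1ℤ → O (suc n) ≡ g x + O n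
  O-suc-offset n x eq = begin
    O (suc n)                                  ≡⟨ O-suc n ⟩
    g (+ 2 * + suc n + 1ℤ - E (suc n)) + O n   ≡⟨ cong (λ i → g (i - E (suc n)) + O n) (sym eq) ⟩
    g (E (suc n) + x - E (suc n)) + O n        ≡⟨ cong (λ i → g i + O n) ([i+j]-i≡j (E (suc n)) x) ⟩
    g x + O n                                  ∎
    where open ≡-Reasoning

  Large : ℕ → Set
  Large n = + 2 * + n + + 2 ≤ E n

  O-suc-stable : ∀ n → Large (suc n) → O (suc n) ≡ O n
  O-suc-stable n large = begin
    O (suc n)                                  ≡⟨ O-suc n ⟩
    g (+ 2 * + suc n + 1ℤ - E (suc n)) + O n   ≡⟨ cong (_+ O n) (g-vanishes index<E) ⟩
    0ℤ + O n                                   ≡⟨ ℤₚ.+-identityˡ (O n) ⟩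
    O n                                        ∎
    where
    open ≡-Reasoning
    index<E : + 2 * + suc n + 1ℤ < E (suc n)
    index<E = ℤₚ.<-≤-trans (ℤₚ.+-monoʳ-< (+ 2 * + suc n) (+<+ (s≤s (s≤s z≤n)))) large

  O≡2m+2⇒E-suc : ∀ m j → O (m ℕ.+ j) ≡ + m + + m + + 2 → E (suc (m ℕ.+ j)) ≡ E j + E (m ℕ.+ j)
  O≡2m+2⇒E-suc m j O≡ = E-suc-offset (m ℕ.+ j) (+ 2 * + j) (trans (cong (_+ + 2 * + j) O≡) (offset (+ m) (+ j)))
    where
    offset : ∀ x y → x + x + + 2 + + 2 * y ≡ + 2 * (1ℤ + (x + y))
    offset = solve-∀

  O≡a+s⇒E-suc : ∀ n s → O n ≡ + A + s → E (suc n) ≡ g (+ 2 * + suc n - s - + A) + g (+ 2 * + suc n - + 2)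
  O≡a+s⇒E-suc n s O≡ = begin
    E (suc n)                      ≡⟨ E-suc n ⟩
    g (+ 2 * + suc n - O n) + E n  ≡⟨ cong₂ (λ i j → g i + g j) (trans (cong (λ o → + 2 * + suc n - o) O≡) (reassoc (+ 2 * + suc n) (+ A) s)) (unshift (+ n)) ⟩
    g (+ 2 * + suc n - s - + A) + g (+ 2 * + suc n - + 2) ∎
    where
    open ≡-Reasoning
    reassoc : ∀ i a s → i - (a + s) ≡ i - s - a
    reassoc = solve-∀
    unshift : ∀ x → + 2 * x ≡ + 2 * (1ℤ + x) - + 2
    unshift = solve-∀

  E-zero : E 0 ≡ + A + + 0
  E-zero = trans at0 (sym (ℤₚ.+-identityʳ (+ A)))

  E-suc-initial : ∀ n → E n ≡ + A + + n → O n ≡ 1ℤ → E (suc n) ≡ + A + + suc n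
  E-suc-initial n E≡ O≡1 = begin
    E (suc n)                  ≡⟨ E-suc-offset n (+ 2 * + n + 1ℤ) (trans (cong (_+ _) O≡1) (offset (+ n))) ⟩
    O n + E n                  ≡⟨ cong₂ _+_ O≡1 E≡ ⟩
    1ℤ + (+ A + + n)           ≡⟨ reorder (+ A) (+ n) ⟩
    + A + + suc n              ∎
    where
    open ≡-Reasoning
    offset : ∀ x → 1ℤ + (+ 2 * x + 1ℤ) ≡ + 2 * (1ℤ + x)
    offset = solve-∀
    reorder : ∀ a x → 1ℤ + (a + x) ≡ a + (1ℤ + x)
    reorder = solve-∀

  initial-segment : ∀ n → suc n ℕ.< A → E n ≡ + A + + n × O n ≡ 1ℤ
  initial-segment zero _ = E-zero , at1
  initial-segment (suc n) 2+n<A with initial-segment n (ℕₚ.<-trans (ℕₚ.n<1+n (suc n)) 2+n<A)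
  ... | E≡ , O≡1 = E≡′ , trans (O-suc-stable n large) O≡1
    where
    E≡′ : E (suc n) ≡ + A + + suc n
    E≡′ = E-suc-initial n E≡ O≡1
    large : Large (suc n)
    large = begin
      + 2 * + suc n + + 2       ≡⟨ split (+ n) ⟩
      + 3 + + n + + suc n       ≤⟨ ℤₚ.+-monoˡ-≤ (+ suc n) (+≤+ 2+n<A) ⟩
      + A + + suc n             ≡⟨ sym E≡′ ⟩
      E (suc n)                 ∎
      where
      open ℤₚ.≤-Reasoning
      split : ∀ x → + 2 * (1ℤ + x) + + 2 ≡ + 3 + x + (1ℤ + x)
      split = solve-∀

  O-below : ∀ n → suc n ℕ.< A → O n ≡ 1ℤ
  O-below n 1+n<A = proj₂ (initial-segment n 1+n<A)

  turning-point : ∀ n → suc (suc n) ≡ A → E (suc n) ≡ + A + + suc n × O (suc n) ≡ + A + 1ℤ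
  turning-point n 2+n≡A with initial-segment n (subst (suc n ℕ.<_) 2+n≡A ℕₚ.≤-refl)
  ... | E≡ , O≡1 = E≡′ , O≡
    where
    E≡′ : E (suc n) ≡ + A + + suc n
    E≡′ = E-suc-initial n E≡ O≡1
    O≡ : O (suc n) ≡ + A + 1ℤ
    O≡ = trans (O-suc-offset n 0ℤ E-hits-index) (cong₂ _+_ at0 O≡1)
      where
      open ≡-Reasoning
      lands-on-zero : ∀ x → + 2 + x + (1ℤ + x) + 0ℤ ≡ + 2 * (1ℤ + x) + 1ℤ
      lands-on-zero = solve-∀
      E-hits-index : E (suc n) + 0ℤ ≡ + 2 * + suc n + 1ℤ
      E-hits-index = begin
        E (suc n) + 0ℤ               ≡⟨ cong (_+ 0ℤ) E≡′ ⟩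
        + A + + suc n + 0ℤ           ≡⟨ cong (λ a → + a + + suc n + 0ℤ) (sym 2+n≡A) ⟩
        + 2 + + n + (1ℤ + + n) + 0ℤ  ≡⟨ lands-on-zero (+ n) ⟩
        + 2 * + suc n + 1ℤ           ∎

  E-below : ∀ n → n ℕ.< A → E n ≡ + A + + n
  E-below zero _ = E-zero
  E-below (suc n) 1+n<A with ℕₚ.m≤n⇒m<n∨m≡n 1+n<A
  ... | inj₁ 2+n<A = proj₁ (initial-segment (suc n) 2+n<A)
  ... | inj₂ 2+n≡A = proj₁ (turning-point n 2+n≡A)

  2≤E : 2 ℕ.≤ A → ∀ {n} → E n ≡ + A + + n → + 2 ≤ E n
  2≤E 2≤A {n} E≡ = subst (+ 2 ≤_) (sym E≡) (+≤+ (ℕₚ.≤-trans 2≤A (ℕₚ.m≤m+n A n)))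

  Settled : ℕ → ℕ → Set
  Settled m n = Large n × O n ≡ + m + + m + + 2

  settled-onwards : ∀ m N → m ℕ.< N → (∀ j → j ℕ.< N → + 2 ≤ E j) → Settled m N →
                    ∀ n → N ℕ.≤ n → Settled m n
  settled-onwards m N m<N E-small settled-N = <-rec (λ n → N ℕ.≤ n → Settled m n) go
    where
    2≤E-before : ∀ {n} → (∀ {j} → j ℕ.< n → N ℕ.≤ j → Settled m j) → ∀ j → j ℕ.< n → + 2 ≤ E j
    2≤E-before rec j j<n with j ℕ.<? N
    ... | yes j<N = E-small j j<N
    ... | no j≮N = ℤₚ.≤-trans (2≤2n+2 j) (proj₁ (rec j<n (ℕₚ.≮⇒≥ j≮N)))

    advance : ∀ n → N ℕ.≤ n → Settled m n → (∀ j → j ℕ.< suc n → + 2 ≤ E j) → Settled m (suc n)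
    advance n N≤n (large , O≡) E-before with ℕₚ.m≤n⇒∃[o]m+o≡n (ℕₚ.<⇒≤ (ℕₚ.<-≤-trans m<N N≤n))
    ... | j , refl = large′ , trans (O-suc-stable (m ℕ.+ j) large′) O≡
      where
      open ℤₚ.≤-Reasoning
      grow : ∀ x → + 2 * (1ℤ + x) + + 2 ≡ + 2 + (+ 2 * x + + 2)
      grow = solve-∀
      large′ : Large (suc (m ℕ.+ j))
      large′ = begin
        + 2 * + suc (m ℕ.+ j) + + 2      ≡⟨ grow (+ (m ℕ.+ j)) ⟩
        + 2 + (+ 2 * + (m ℕ.+ j) + + 2)  ≤⟨ ℤₚ.+-mono-≤ (E-before j (s≤s (ℕₚ.m≤n+m j m))) large ⟩
        E j + E (m ℕ.+ j)                ≡⟨ sym (O≡2m+2⇒E-suc m j O≡) ⟩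
        E (suc (m ℕ.+ j))                ∎

    go : ∀ n → (∀ {j} → j ℕ.< n → N ℕ.≤ j → Settled m j) → N ℕ.≤ n → Settled m n
    go n rec N≤n with ℕₚ.m≤n⇒m<n∨m≡n N≤n
    ... | inj₂ refl = settled-N
    go (suc n) rec _ | inj₁ (s≤s N≤n) = advance n N≤n (rec ℕₚ.≤-refl N≤n) (2≤E-before rec)

EvenClosedForm : ℤ → (ℤ → ℤ) → Set
EvenClosedForm a g = (n : ℕ) →
  ((+ n < a + 1ℤ → g (+ 2 * + n) ≡ a + + n)
    × (+ n ≥ a + 1ℤ → g (+ 2 * + n) ≡ g (+ 2 * + n - + 2 - a) + g (+ 2 * + n - + 2)))
  × ((+ n < a - 1ℤ → g (+ 2 * + n + 1ℤ) ≡ 1ℤ)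
    × (+ n ≡ a - 1ℤ → g (+ 2 * + n + 1ℤ) ≡ a + 1ℤ)
    × (+ n > a - 1ℤ → g (+ 2 * + n + 1ℤ) ≡ a + + 2))

OddClosedForm : ℤ → (ℤ → ℤ) → Set
OddClosedForm a g = (n : ℕ) →
  ((+ n < a → g (+ 2 * + n) ≡ a + + n)
    × (+ n ≥ a → g (+ 2 * + n) ≡ g (+ 2 * + n - 1ℤ - a) + g (+ 2 * + n - + 2)))
  × ((+ n < a - 1ℤ → g (+ 2 * + n + 1ℤ) ≡ 1ℤ)
    × (+ n ≥ a - 1ℤ → g (+ 2 * + n + 1ℤ) ≡ a + 1ℤ))

module Even (k : ℕ) {g : ℤ → ℤ} (isG : IsG (+ ((2 ℕ.+ k) ℕ.+ (2 ℕ.+ k))) g) where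
  open IsG isG using (at1)
  open Solution isG

  K A : ℕ
  K = 2 ℕ.+ k
  A = K ℕ.+ K

  K<A : K ℕ.< A
  K<A = ℕₚ.m<m+n K (s≤s z≤n)

  E-A-1 : E (suc (k ℕ.+ K)) ≡ + A + + suc (k ℕ.+ K)
  E-A-1 = proj₁ (turning-point (k ℕ.+ K) refl)

  O-A-1 : O (suc (k ℕ.+ K)) ≡ + A + 1ℤ
  O-A-1 = proj₂ (turning-point (k ℕ.+ K) refl)

  E-A : E A ≡ + A + + A
  E-A = begin
    E A                            ≡⟨ E-suc-offset (suc (k ℕ.+ K)) (+ 2 * + suc k + 1ℤ) (trans (cong (_+ _) O-A-1) (offset (+ k))) ⟩
    O (suc k) + E (suc (k ℕ.+ K))  ≡⟨ cong₂ _+_ (O-below (suc k) K<A) E-A-1 ⟩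
    1ℤ + (+ A + + suc (k ℕ.+ K))   ≡⟨ doubled (+ k) ⟩
    + A + + A                      ∎
    where
    open ≡-Reasoning
    offset : ∀ x → let κ = + 2 + x in κ + κ + 1ℤ + (+ 2 * (1ℤ + x) + 1ℤ) ≡ + 2 * (+ 2 + (x + κ))
    offset = solve-∀
    doubled : ∀ x → let κ = + 2 + x in 1ℤ + (κ + κ + (1ℤ + (x + κ))) ≡ κ + κ + (κ + κ)
    doubled = solve-∀

  O-A : O A ≡ + A + + 2
  O-A = begin
    O A                       ≡⟨ O-suc-offset (suc (k ℕ.+ K)) 1ℤ (trans (cong (_+ 1ℤ) E-A) (offset (+ A))) ⟩
    g 1ℤ + O (suc (k ℕ.+ K))  ≡⟨ cong₂ _+_ at1 O-A-1 ⟩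
    1ℤ + (+ A + 1ℤ)           ≡⟨ reorder (+ A) ⟩
    + A + + 2                 ∎
    where
    open ≡-Reasoning
    offset : ∀ a → a + a + 1ℤ ≡ + 2 * a + 1ℤ
    offset = solve-∀
    reorder : ∀ a → 1ℤ + (a + 1ℤ) ≡ a + + 2
    reorder = solve-∀

  E-upto : ∀ n → n ℕ.≤ A → E n ≡ + A + + n
  E-upto n n≤A with ℕₚ.m≤n⇒m<n∨m≡n n≤A
  ... | inj₁ n<A = E-below n n<A
  ... | inj₂ refl = E-A

  E-1+A : E (suc A) ≡ + A + + K + (+ A + + A)
  E-1+A = trans (O≡2m+2⇒E-suc K K O-A) (cong₂ _+_ (E-below K K<A) E-A)

  large-1+A : Large (suc A)
  large-1+A = begin
    + 2 * + suc A + + 2                            ≤⟨ ℤₚ.i≤i+j _ (+ (k ℕ.+ k ℕ.+ k ℕ.+ 2)) ⟩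
    + 2 * + suc A + + 2 + + (k ℕ.+ k ℕ.+ k ℕ.+ 2)  ≡⟨ surplus (+ k) ⟩
    + A + + K + (+ A + + A)                        ≡⟨ sym E-1+A ⟩
    E (suc A)                                      ∎
    where
    open ℤₚ.≤-Reasoning
    surplus : ∀ x → let κ = + 2 + x in
              + 2 * (1ℤ + (κ + κ)) + + 2 + (x + x + x + + 2) ≡ κ + κ + κ + (κ + κ + (κ + κ))
    surplus = solve-∀

  settled-1+A : Settled K (suc A)
  settled-1+A = large-1+A , trans (O-suc-stable A large-1+A) O-A

  O-above : ∀ n → A ℕ.≤ n → O n ≡ + A + + 2
  O-above n A≤n with ℕₚ.m≤n⇒m<n∨m≡n A≤n
  ... | inj₁ A<n = proj₂ (settled-onwards K (suc A) (ℕₚ.m<n⇒m<1+n K<A) E-small settled-1+A n A<n)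
    where
    E-small : ∀ j → j ℕ.< suc A → + 2 ≤ E j
    E-small j j<1+A = 2≤E (s≤s (s≤s z≤n)) (E-upto j (ℕ.s≤s⁻¹ j<1+A))
  ... | inj₂ refl = O-A

  E-beyond : ∀ n → A ℕ.< n → E n ≡ g (+ 2 * + n - + 2 - + A) + g (+ 2 * + n - + 2)
  E-beyond (suc n) (s≤s A≤n) = O≡a+s⇒E-suc n (+ 2) (O-above n A≤n)

  closed-form : EvenClosedForm (+ A) g
  closed-form n =
    ( (λ n<A+1 → E-upto n (ℕ.s≤s⁻¹ (subst (suc n ℕ.≤_) (ℕₚ.+-comm A 1) (ℤₚ.drop‿+<+ n<A+1))))
    , (λ n≥A+1 → E-beyond n (subst (ℕ._≤ n) (ℕₚ.+-comm A 1) (ℤₚ.drop‿+≤+ n≥A+1))) )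
    , ( (λ n<A-1 → O-below n (s≤s (ℤₚ.drop‿+<+ n<A-1)))
      , (λ n≡A-1 → subst (λ i → O i ≡ + A + 1ℤ) (sym (ℤₚ.+-injective n≡A-1)) O-A-1)
      , (λ n>A-1 → O-above n (ℤₚ.drop‿+<+ n>A-1)) )

module Odd (k : ℕ) {g : ℤ → ℤ} (isG : IsG (+ suc ((1 ℕ.+ k) ℕ.+ (1 ℕ.+ k))) g) where
  open Solution isG

  K A : ℕ
  K = 1 ℕ.+ k
  A = suc (K ℕ.+ K)

  K<A : K ℕ.< A
  K<A = s≤s (ℕₚ.m≤m+n K K)

  A+1≡2K+2 : + A + 1ℤ ≡ + K + + K + + 2
  A+1≡2K+2 = reorder (+ K)
    where
    reorder : ∀ x → 1ℤ + (x + x) + 1ℤ ≡ x + x + + 2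
    reorder = solve-∀

  E-A-1 : E (K ℕ.+ K) ≡ + A + + (K ℕ.+ K)
  E-A-1 = proj₁ (turning-point (k ℕ.+ K) refl)

  O-A-1 : O (K ℕ.+ K) ≡ + A + 1ℤ
  O-A-1 = proj₂ (turning-point (k ℕ.+ K) refl)

  E-A : E A ≡ + A + + K + (+ A + + (K ℕ.+ K))
  E-A = trans (O≡2m+2⇒E-suc K K (trans O-A-1 A+1≡2K+2)) (cong₂ _+_ (E-below K K<A) E-A-1)

  large-A : Large A
  large-A = begin
    + 2 * + A + + 2                            ≤⟨ ℤₚ.i≤i+j _ (+ (k ℕ.+ k ℕ.+ k ℕ.+ 1)) ⟩
    + 2 * + A + + 2 + + (k ℕ.+ k ℕ.+ k ℕ.+ 1)  ≡⟨ surplus (+ k) ⟩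
    + A + + K + (+ A + + (K ℕ.+ K))            ≡⟨ sym E-A ⟩
    E A                                        ∎
    where
    open ℤₚ.≤-Reasoning
    surplus : ∀ x → let κ = 1ℤ + x; a = 1ℤ + (κ + κ) in
              + 2 * a + + 2 + (x + x + x + 1ℤ) ≡ a + κ + (a + (κ + κ))
    surplus = solve-∀

  settled-A : Settled K A
  settled-A = large-A , trans (O-suc-stable (K ℕ.+ K) large-A) (trans O-A-1 A+1≡2K+2)

  O-above : ∀ n → K ℕ.+ K ℕ.≤ n → O n ≡ + A + 1ℤ
  O-above n K+K≤n with ℕₚ.m≤n⇒m<n∨m≡n K+K≤n
  ... | inj₁ A≤n = trans (proj₂ (settled-onwards K A K<A E-small settled-A n A≤n)) (sym A+1≡2K+2)
    where
    E-small : ∀ j → j ℕ.< A → + 2 ≤ E j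
    E-small j j<A = 2≤E (s≤s (s≤s z≤n)) (E-below j j<A)
  ... | inj₂ refl = O-A-1

  E-beyond : ∀ n → A ℕ.≤ n → E n ≡ g (+ 2 * + n - 1ℤ - + A) + g (+ 2 * + n - + 2)
  E-beyond (suc n) (s≤s K+K≤n) = O≡a+s⇒E-suc n 1ℤ (O-above n K+K≤n)

  closed-form : OddClosedForm (+ A) g
  closed-form n =
    ( (λ n<A → E-below n (ℤₚ.drop‿+<+ n<A))
    , (λ n≥A → E-beyond n (ℤₚ.drop‿+≤+ n≥A)) )
    , ( (λ n<A-1 → O-below n (s≤s (ℤₚ.drop‿+<+ n<A-1)))
      , (λ n≥A-1 → O-above n (ℤₚ.drop‿+≤+ n≥A-1)) )

even-or-odd : ∀ n → (∃[ k ] n ≡ k ℕ.+ k) ⊎ (∃[ k ] n ≡ suc (k ℕ.+ k))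
even-or-odd zero = inj₁ (0 , refl)
even-or-odd (suc n) with even-or-odd n
... | inj₁ (k , n≡k+k) = inj₂ (k , cong suc n≡k+k)
... | inj₂ (k , n≡1+k+k) = inj₁ (suc k , cong suc (trans n≡1+k+k (sym (ℕₚ.+-suc k k))))

large-even-or-odd : ∀ {n} → 3 ℕ.≤ n →
  (∃[ k ] n ≡ (2 ℕ.+ k) ℕ.+ (2 ℕ.+ k)) ⊎ (∃[ k ] n ≡ suc ((1 ℕ.+ k) ℕ.+ (1 ℕ.+ k)))
large-even-or-odd {n} 3≤n with even-or-odd n
... | inj₁ (suc (suc k) , n≡) = inj₁ (k , n≡)
... | inj₂ (suc k , n≡) = inj₂ (k , n≡)
... | inj₁ (0 , refl) = contradiction 3≤n λ ()
... | inj₁ (1 , refl) = contradiction 3≤n λ { (s≤s (s≤s ())) }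
... | inj₂ (0 , refl) = contradiction 3≤n λ { (s≤s ()) }

2∣n+n : ∀ n → + 2 ∣ + (n ℕ.+ n)
2∣n+n n = divides n (trans (cong (n ℕ.+_) (sym (ℕₚ.+-identityʳ n))) (ℕₚ.*-comm 2 n))

2∤1+n+n : ∀ n → ¬ + 2 ∣ + suc (n ℕ.+ n)
2∤1+n+n n 2∣1+n+n = contradiction (∣1⇒≡1 (∣m+n∣m⇒∣n 2∣n+n+1 (2∣n+n n))) λ ()
  where
  2∣n+n+1 : + 2 ∣ + (n ℕ.+ n ℕ.+ 1)
  2∣n+n+1 = subst (λ i → + 2 ∣ + i) (ℕₚ.+-comm 1 (n ℕ.+ n)) 2∣1+n+n

theorem6p5 : (a : ℤ) → + 3 ≤ a → (g : ℤ → ℤ) → IsG a g →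
    (+ 2 ∣ a →
      ((n : ℕ) →
        ((+ n < a + 1ℤ → g (+ 2 * + n) ≡ a + + n)
          × (+ n ≥ a + 1ℤ → g (+ 2 * + n) ≡ g (+ 2 * + n - + 2 - a) + g (+ 2 * + n - + 2)))
        × ((+ n < a - 1ℤ → g (+ 2 * + n + 1ℤ) ≡ 1ℤ)
          × (+ n ≡ a - 1ℤ → g (+ 2 * + n + 1ℤ) ≡ a + 1ℤ)
          × (+ n > a - 1ℤ → g (+ 2 * + n + 1ℤ) ≡ a + + 2))))
    × (¬ (+ 2 ∣ a) →
      ((n : ℕ) →
        ((+ n < a → g (+ 2 * + n) ≡ a + + n)
          × (+ n ≥ a → g (+ 2 * + n) ≡ g (+ 2 * + n - 1ℤ - a) + g (+ 2 * + n - + 2)))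
        × ((+ n < a - 1ℤ → g (+ 2 * + n + 1ℤ) ≡ 1ℤ)
          × (+ n ≥ a - 1ℤ → g (+ 2 * + n + 1ℤ) ≡ a + 1ℤ))))
theorem6p5 (+ A) (+≤+ 3≤A) g isG with large-even-or-odd 3≤A
... | inj₁ (k , refl) = (λ _ → Even.closed-form k isG) , (λ 2∤A → contradiction (2∣n+n (2 ℕ.+ k)) 2∤A)
... | inj₂ (k , refl) = (λ 2∣A → contradiction 2∣A (2∤1+n+n (1 ℕ.+ k))) , (λ _ → Odd.closed-form k isG)
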